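{- For every integer $i\ge 0$, let $s_i$ denote the first (smallest) term of the sequence $S_i$ defined in the context. Then for every $i\ge 0$, the base-3 representation of $s_i$ is the same string as the base-$\frac{3}{2}$ representation of $2i$. Equivalently, the Stanley cross-sequence $(s_0,s_1,s_2,\dots)$ written in base 3 coincides, term by term, with the sequence of even non-negative integers $0,2,4,\dots$ written in base $\frac{3}{2}$.
   Context: A sequence (or set) of integers is 3-free if it contains no three distinct terms $x<y<z$ with $y-x=z-y$. The greedy partition of the non-negative integers into 3-free sequences is defined as follows. $S_0$ is the lexicographically earliest 3-free sequence of non-negative integers: it is increasing, starts with $0$, and each next term is the smallest integer larger than the previous term that creates no 3-term arithmetic progression with earlier terms. For $n\ge1$, $S_n$ is the lexicographically earliest 3-free increasing sequence of non-negative integers that are not used in any $S_i$ with $i<n$: it starts with the smallest non-negative integer not in $\bigcup_{i<n}S_i$, and each next term is the smallest integer larger than the previous term, not in $\bigcup_{i<n}S_i$, that creates no 3-term arithmetic progression with earlier terms of $S_n$. (Each $S_n$ is infinite and exists for all $n$.) The sequence of first terms of $S_0,S_1,S_2,\dots$ is called the Stanley cross-sequence ($0,2,7,21,23,64,\dots$). Base-$\frac32$ representation: the representation of $0$ is the string $0$; for $N\ge1$ write $N=3q+r$ with $r\in\{0,1,2\}$; if $q=0$ the representation is the one-digit string $r$, otherwise it is the base-$\frac32$ representation of $2q$ followed by the digit $r$. (E.g. $3\mapsto 20$, $5\mapsto 22$, $6\mapsto 210$.) A string $a_n\cdots a_0$ with digits in $\{0,1,2\}$ then satisfies $N=\sum_k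 a_k(3/2)^k$. The base-3 representation is the usual ternary one (with $0\mapsto 0$). -}

module Defs where

open import Data.Nat using (ℕ; zero; suc; _+_; _*_; _<_; _≡ᵇ_; _<ᵇ_)
open import Data.Nat.DivMod using (_/_; _%_)
open import Data.Bool using (Bool; true; false; not; _∧_; _∨_; if_then_else_)
open import Data.List using (List; []; _∷_; _++_; reverse)
open import Data.Bool.ListAction using (any)
open import Data.Product using (_×_)
open import Relation.Binary.PropositionalEquality using (_≡_)
open import Relation.Nullary using (¬_)

createsAP : List ℕ → ℕ → Bool
createsAP L m = any (λ x → any (λ y → (x <ᵇ y) ∧ ((x + m) ≡ᵇ (2 * y))) L) L

-- Given h n = list of the terms of S_n that are
-- smaller than m, decide whether m belongs to S_n:
--   joins h m n     : m ∈ S_n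
--   usedBefore h m n: m ∈ S_i for some i < n
-- m ∈ S_n  iff  m is not used by S_0..S_{n-1} and m creates no 3-AP with
-- the earlier terms of S_n.  (If all of 0..m-1 are used, m is the first
-- term of S_n and there are no earlier terms.)

mutual
  usedBefore : (ℕ → List ℕ) → ℕ → ℕ → Bool
  usedBefore h m zero    = false
  usedBefore h m (suc n) = usedBefore h m n ∨ joins h m n

  joins : (ℕ → List ℕ) → ℕ → ℕ → Bool
  joins h m n = not (usedBefore h m n) ∧ not (createsAP (h n) m)

hist : ℕ → ℕ → List ℕ
hist zero    n = []
hist (suc m) n = hist m n ++ (if joins (hist m) m n then m ∷ [] else [])

InS : ℕ → ℕ → Set
InS n m = joins (hist m) m n ≡ true

IsFirstTerm : ℕ → ℕ → Set
IsFirstTerm n m = InS n m × (∀ k → k < m → ¬ InS n k)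

-- Digit strings (most significant digit first), as lists of naturals.

-- base 3, least significant first, for positive n (fuel = n suffices)
base3go : ℕ → ℕ → List ℕ
base3go zero    n = []
base3go (suc f) n with n / 3
... | zero  = n % 3 ∷ []
... | suc q = n % 3 ∷ base3go f (suc q)

base3 : ℕ → List ℕ
base3 zero    = 0 ∷ []
base3 (suc n) = reverse (base3go (suc n) (suc n))

-- base 3/2: N = 3q + r; if q = 0 the string is r, otherwise it is the
-- representation of 2q followed by r.  (fuel = N suffices: 2q < N.)
base32go : ℕ → ℕ → List ℕ
base32go zero    n = []
base32go (suc f) n with n / 3
... | zero  = n % 3 ∷ []
... | suc q = n % 3 ∷ base32go f (2 * suc q)

base32 : ℕ → List ℕ
base32 zero    = 0 ∷ []
base32 (suc n) = reverse (base32go (suc n) (suc n))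

-- Define own : ℕ → ℕ by own (3b + t) = ⌊ (3 · own b + t) / 2 ⌋ for a last digit t < 3.
-- The greedy partition is exactly the partition into the classes {m | own m = n}, that is
-- m ∈ S_(own m).  Two facts about these classes suffice, both proved by strong induction
-- through the ternary parent b of m = 3b + t:
--   * each class is 3-free: the last digits of a progression inside one class agree, and
--     then the parents form a progression inside one smaller class;
--   * m is blocked from every earlier class: for n < own m there are x < y < m with
--     own x = own y = n and x + m = 2y.  This is proved together with two companion
--     configurations; each case of last digits is covered by a lifting rule, and the
--     existence of the rules is a finite check carried out by evaluation.
-- Simulating the greedy definition with these facts gives m ∈ S_n ⟺ own m = n.
-- Finally, if s is the first term of S_q and 2i = 3q + ρ (ρ < 3), then 3s + ρ is the first
-- term of S_i.  Appending the digit ρ is one step of the base-3 expansion of s_i and one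
-- step of the base-3/2 expansion of 2i, so the theorem follows by induction on i.
module Submission where

open import Defs
open import Data.Nat
open import Data.Nat.Properties
open import Data.Nat.DivMod
open import Data.Nat.Induction using (<-rec)
open import Data.Nat.Tactic.RingSolver using (solve-∀)
open import Data.Product using (Σ; ∃; _×_; _,_; proj₁; proj₂)
open import Data.Sum using (_⊎_; inj₁; inj₂)
open import Data.Empty using (⊥; ⊥-elim)
open import Data.Bool using (Bool; true; false; not; _∧_; _∨_)
open import Data.Bool.Properties using (T-≡; T-∧; ∧-zeroʳ; ∨-zeroʳ)
open import Data.Unit using (⊤; tt)
open import Data.List using (List; []; _∷_; _++_; concatMap; map; reverse)
open import Data.List.Properties using (unfold-reverse)
open import Data.List.Membership.Propositional using (_∈_; find; lose)
open import Data.List.Membership.Propositional.Properties using (∈-++⁻; ∈-++⁺ˡ; ∈-++⁺ʳ)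
open import Data.List.Relation.Unary.Any.Properties using (any⁺; any⁻)
open import Data.List.Relation.Unary.All as All using (All; all?)
open import Data.List.Relation.Unary.Any using (Any; here; there; any?; satisfied)
open import Relation.Nullary using (¬_; Dec; yes; no; _×-dec_)
open import Relation.Nullary.Decidable using (toWitness)
open import Relation.Binary.PropositionalEquality
open import Relation.Binary.Definitions using (tri<; tri≈; tri>)
open import Function.Bundles using (Equivalence)

div-mod-3 : ∀ n → 3 * (n / 3) + n % 3 ≡ n
div-mod-3 n = trans (trans (+-comm (3 * (n / 3)) (n % 3)) (cong (n % 3 +_) (*-comm 3 (n / 3))))
                    (sym (m≡m%n+[m/n]*n n 3))

data Ternary : ℕ → Set where
  ternary : ∀ b t → t < 3 → Ternary (3 * b + t)

ternary-view : ∀ n → Ternary n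
ternary-view n = subst Ternary (div-mod-3 n) (ternary (n / 3) (n % 3) (m%n<n n 3))

≡-mod3 : ∀ A B {r r'} → 3 * A + r ≡ 3 * B + r' → r % 3 ≡ r' % 3
≡-mod3 A B {r} {r'} e = begin
  r % 3                 ≡⟨ [m+kn]%n≡m%n r A 3 ⟨
  (r + A * 3) % 3       ≡⟨ cong (_% 3) (shuffle A r) ⟩
  (3 * A + r) % 3       ≡⟨ cong (_% 3) e ⟩
  (3 * B + r') % 3      ≡⟨ cong (_% 3) (shuffle B r') ⟨
  (r' + B * 3) % 3      ≡⟨ [m+kn]%n≡m%n r' B 3 ⟩
  r' % 3                ∎
  where
  open ≡-Reasoning
  shuffle : ∀ a s → s + a * 3 ≡ 3 * a + s
  shuffle = solve-∀

digit-unique : ∀ {a b r r'} → r < 3 → r' < 3 → 3 * a + r ≡ 3 * b + r' → a ≡ b × r ≡ r'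
digit-unique {a} {b} {r} {r'} r<3 r'<3 e = *-cancelˡ-≡ a b 3 (+-cancelʳ-≡ r _ _ e′) , same-digit
  where
  same-digit : r ≡ r'
  same-digit = trans (sym (m<n⇒m%n≡m r<3)) (trans (≡-mod3 a b e) (m<n⇒m%n≡m r'<3))
  e′ : 3 * a + r ≡ 3 * b + r
  e′ = trans e (cong (3 * b +_) (sym same-digit))

divmod-digit : ∀ b t → t < 3 → (3 * b + t) / 3 ≡ b × (3 * b + t) % 3 ≡ t
divmod-digit b t t<3 = digit-unique (m%n<n (3 * b + t) 3) t<3 (div-mod-3 (3 * b + t))

ternary-< : ∀ {α β ρx ρy} → ρx < 3 → α < β → 3 * α + ρx < 3 * β + ρy
ternary-< {α} {β} {ρx} {ρy} ρx<3 α<β = begin-strict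
  3 * α + ρx   <⟨ +-monoʳ-< (3 * α) ρx<3 ⟩
  3 * α + 3    ≡⟨ +-comm (3 * α) 3 ⟩
  3 + 3 * α    ≡⟨ *-suc 3 α ⟨
  3 * suc α    ≤⟨ *-monoʳ-≤ 3 α<β ⟩
  3 * β        ≤⟨ m≤m+n (3 * β) ρy ⟩
  3 * β + ρy   ∎
  where open ≤-Reasoning

parent< : ∀ b t → 0 < 3 * b + t → b < 3 * b + t
parent< zero    t pos = pos
parent< (suc b) t _   = ≤-trans (m≤m+n (2 + b) (2 * b + 1 + t)) (≤-reflexive (regroup b t))
  where
  regroup : ∀ b t → 2 + b + (2 * b + 1 + t) ≡ 3 * suc b + t
  regroup = solve-∀

⌊2a+k/2⌋ : ∀ a k → ⌊ 2 * a + k /2⌋ ≡ a + ⌊ k /2⌋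
⌊2a+k/2⌋ zero    k = refl
⌊2a+k/2⌋ (suc a) k = trans (cong ⌊_/2⌋ (unfold a k)) (cong suc (⌊2a+k/2⌋ a k))
  where
  unfold : ∀ a k → 2 * suc a + k ≡ 2 + (2 * a + k)
  unfold = solve-∀

⌊2a/2⌋ : ∀ a → ⌊ 2 * a /2⌋ ≡ a
⌊2a/2⌋ a = trans (cong ⌊_/2⌋ (sym (+-identityʳ (2 * a))))
                 (trans (⌊2a+k/2⌋ a 0) (+-identityʳ a))

halves : ∀ s → s ≡ 2 * ⌊ s /2⌋ ⊎ s ≡ 1 + 2 * ⌊ s /2⌋
halves zero = inj₁ refl
halves (suc zero) = inj₂ refl
halves (suc (suc s)) with halves s
... | inj₁ e = inj₁ (trans (cong (2 +_) e) (sym (*-suc 2 ⌊ s /2⌋)))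
... | inj₂ e = inj₂ (trans (cong (2 +_) e) (cong suc (sym (*-suc 2 ⌊ s /2⌋))))

2⌊s/2⌋≤s : ∀ s → 2 * ⌊ s /2⌋ ≤ s
2⌊s/2⌋≤s s with halves s
... | inj₁ e = ≤-reflexive (sym e)
... | inj₂ e = ≤-trans (n≤1+n _) (≤-reflexive (sym e))

-- The owner function: own m will turn out to be the index of the sequence containing m.
-- It is defined with fuel (m / 3 < m for m > 0) and characterised by own-digit.

ownFuel : ℕ → ℕ → ℕ
ownFuel zero    m = 0
ownFuel (suc f) m = ⌊ 3 * ownFuel f (m / 3) + m % 3 /2⌋

own : ℕ → ℕ
own m = ownFuel (suc m) m

ownFuel-zero : ∀ f → ownFuel f 0 ≡ 0
ownFuel-zero zero    = refl
ownFuel-zero (suc f) = cong (λ v → ⌊ 3 * v + 0 /2⌋) (ownFuel-zero f)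

ownFuel-stable : ∀ f g m → m < f → m < g → ownFuel f m ≡ ownFuel g m
ownFuel-stable f g zero _ _ = trans (ownFuel-zero f) (sym (ownFuel-zero g))
ownFuel-stable (suc f) (suc g) m@(suc _) (s≤s m≤f) (s≤s m≤g) =
  cong (λ v → ⌊ 3 * v + m % 3 /2⌋)
       (ownFuel-stable f g (m / 3) (<-≤-trans m/3<m m≤f) (<-≤-trans m/3<m m≤g))
  where
  m/3<m : m / 3 < m
  m/3<m = m/n<m m 3 (s≤s (s≤s z≤n))

own-digit : ∀ b t → t < 3 → own (3 * b + t) ≡ ⌊ 3 * own b + t /2⌋
own-digit b t t<3 = begin
  own m                                     ≡⟨ unfold m ⟩
  ⌊ 3 * own (m / 3) + m % 3 /2⌋             ≡⟨ cong₂ (λ p r → ⌊ 3 * own p + r /2⌋) q r ⟩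
  ⌊ 3 * own b + t /2⌋                       ∎
  where
  open ≡-Reasoning
  m = 3 * b + t
  q = proj₁ (divmod-digit b t t<3)
  r = proj₂ (divmod-digit b t t<3)
  unfold : ∀ m → own m ≡ ⌊ 3 * own (m / 3) + m % 3 /2⌋
  unfold zero        = refl
  unfold m@(suc _)   = cong (λ v → ⌊ 3 * v + m % 3 /2⌋)
    (ownFuel-stable m (suc (m / 3)) (m / 3) (m/n<m m 3 (s≤s (s≤s z≤n))) ≤-refl)

own-lift : ∀ α j c {ρ} → ρ < 3 → own α ≡ 2 * j + c → own (3 * α + ρ) ≡ 3 * j + ⌊ 3 * c + ρ /2⌋
own-lift α j c {ρ} ρ<3 oα = begin
  own (3 * α + ρ)                   ≡⟨ own-digit α ρ ρ<3 ⟩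
  ⌊ 3 * own α + ρ /2⌋               ≡⟨ cong (λ v → ⌊ 3 * v + ρ /2⌋) oα ⟩
  ⌊ 3 * (2 * j + c) + ρ /2⌋         ≡⟨ cong ⌊_/2⌋ (regroup j c ρ) ⟩
  ⌊ 2 * (3 * j) + (3 * c + ρ) /2⌋   ≡⟨ ⌊2a+k/2⌋ (3 * j) (3 * c + ρ) ⟩
  3 * j + ⌊ 3 * c + ρ /2⌋           ∎
  where
  open ≡-Reasoning
  regroup : ∀ j c ρ → 3 * (2 * j + c) + ρ ≡ 2 * (3 * j) + (3 * c + ρ)
  regroup = solve-∀

class-slot : ∀ a {ρ n} → ρ < 3 → own (3 * a + ρ) ≡ n →
  3 * own a + ρ ≡ 2 * n ⊎ 3 * own a + ρ ≡ 1 + 2 * n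
class-slot a {ρ} ρ<3 refl with halves (3 * own a + ρ)
... | inj₁ e = inj₁ (trans e (cong (λ v → 2 * v) (sym (own-digit a ρ ρ<3))))
... | inj₂ e = inj₂ (trans e (cong (λ v → 1 + 2 * v) (sym (own-digit a ρ ρ<3))))

-- Every sequence is 3-free.

NoAPEndingAt : ℕ → Set
NoAPEndingAt z = ∀ x y → x < y → own x ≡ own z → own y ≡ own z → x + z ≡ 2 * y → ⊥

ap-third-digit : ∀ α β γ ρx ρy ρz → ρz < 3 →
  (3 * α + ρx) + (3 * γ + ρz) ≡ 2 * (3 * β + ρy) → ρz ≡ (2 * (ρx + ρy)) % 3
ap-third-digit α β γ ρx ρy ρz ρz<3 e =
  trans (sym (m<n⇒m%n≡m ρz<3)) (≡-mod3 (γ + 3 * α + ρx) (2 * α + 2 * β) z+3x≡2[x+y])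
  where
  open ≡-Reasoning
  x = 3 * α + ρx
  z+3x≡2[x+y] : 3 * (γ + 3 * α + ρx) + ρz ≡ 3 * (2 * α + 2 * β) + 2 * (ρx + ρy)
  z+3x≡2[x+y] = begin
    3 * (γ + 3 * α + ρx) + ρz        ≡⟨ l α γ ρx ρz ⟩
    x + (3 * γ + ρz) + 2 * x         ≡⟨ cong (_+ 2 * x) e ⟩
    2 * (3 * β + ρy) + 2 * x         ≡⟨ r α β ρx ρy ⟩
    3 * (2 * α + 2 * β) + 2 * (ρx + ρy) ∎
    where
    l : ∀ α γ ρx ρz → 3 * (γ + 3 * α + ρx) + ρz ≡ 3 * α + ρx + (3 * γ + ρz) + 2 * (3 * α + ρx)
    l = solve-∀
    r : ∀ α β ρx ρy → 2 * (3 * β + ρy) + 2 * (3 * α + ρx) ≡ 3 * (2 * α + 2 * β) + 2 * (ρx + ρy)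
    r = solve-∀

ap-digits : ∀ ρx ρy {ρz} → ρx < 3 → ρy < 3 → ρz ≡ (2 * (ρx + ρy)) % 3 →
  (ρx ≡ ρy × ρz ≡ ρy) ⊎ (ρx ≢ ρy × ρx ≢ ρz × ρy ≢ ρz)
ap-digits 0 0 _ _ refl = inj₁ (refl , refl)
ap-digits 0 1 _ _ refl = inj₂ ((λ ()) , (λ ()) , (λ ()))
ap-digits 0 2 _ _ refl = inj₂ ((λ ()) , (λ ()) , (λ ()))
ap-digits 1 0 _ _ refl = inj₂ ((λ ()) , (λ ()) , (λ ()))
ap-digits 1 1 _ _ refl = inj₁ (refl , refl)
ap-digits 1 2 _ _ refl = inj₂ ((λ ()) , (λ ()) , (λ ()))
ap-digits 2 0 _ _ refl = inj₂ ((λ ()) , (λ ()) , (λ ()))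
ap-digits 2 1 _ _ refl = inj₂ ((λ ()) , (λ ()) , (λ ()))
ap-digits 2 2 _ _ refl = inj₁ (refl , refl)
ap-digits (suc (suc (suc _))) _ (s≤s (s≤s (s≤s ()))) _ _
ap-digits _ (suc (suc (suc _))) _ (s≤s (s≤s (s≤s ()))) _

same-slot : ∀ A B {ρ ρ' s} → ρ < 3 → ρ' < 3 → 3 * A + ρ ≡ s → 3 * B + ρ' ≡ s → ρ ≡ ρ'
same-slot A B ρ<3 ρ'<3 e e' = proj₂ (digit-unique {A} {B} ρ<3 ρ'<3 (trans e (sym e')))

-- A sequence contains no three members whose last digits are pairwise distinct:
-- they would need three distinct slots among 2n and 2n + 1.
no-three-digits : ∀ a b c {ρx ρy ρz n} → ρx < 3 → ρy < 3 → ρz < 3 →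
  own (3 * a + ρx) ≡ n → own (3 * b + ρy) ≡ n → own (3 * c + ρz) ≡ n →
  ρx ≢ ρy → ρx ≢ ρz → ρy ≢ ρz → ⊥
no-three-digits a b c lx ly lz ox oy oz x≢y x≢z y≢z
  with class-slot a lx ox | class-slot b ly oy | class-slot c lz oz
... | inj₁ p | inj₁ q | _      = x≢y (same-slot (own a) (own b) lx ly p q)
... | inj₂ p | inj₂ q | _      = x≢y (same-slot (own a) (own b) lx ly p q)
... | inj₁ p | inj₂ _ | inj₁ r = x≢z (same-slot (own a) (own c) lx lz p r)
... | inj₂ p | inj₁ _ | inj₂ r = x≢z (same-slot (own a) (own c) lx lz p r)
... | inj₁ _ | inj₂ q | inj₂ r = y≢z (same-slot (own b) (own c) ly lz q r)
... | inj₂ _ | inj₁ q | inj₁ r = y≢z (same-slot (own b) (own c) ly lz q r)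

not-consecutive : ∀ A B ρ → ρ < 3 → 3 * A + ρ ≢ 1 + (3 * B + ρ)
not-consecutive A B ρ ρ<3 e = distinct-residues ρ<3 (≡-mod3 A B (trans e (sym (+-suc (3 * B) ρ))))
  where
  distinct-residues : ∀ {ρ} → ρ < 3 → ρ % 3 ≢ suc ρ % 3
  distinct-residues {0} _ ()
  distinct-residues {1} _ ()
  distinct-residues {2} _ ()
  distinct-residues {suc (suc (suc _))} (s≤s (s≤s (s≤s ())))

same-digit-parents : ∀ a c {ρ} → ρ < 3 → own (3 * a + ρ) ≡ own (3 * c + ρ) → own a ≡ own c
same-digit-parents a c {ρ} ρ<3 oa with class-slot a ρ<3 oa | class-slot c ρ<3 refl
... | inj₁ p | inj₁ q = proj₁ (digit-unique {own a} {own c} ρ<3 ρ<3 (trans p (sym q)))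
... | inj₂ p | inj₂ q = proj₁ (digit-unique {own a} {own c} ρ<3 ρ<3 (trans p (sym q)))
... | inj₁ p | inj₂ q = ⊥-elim (not-consecutive (own c) (own a) ρ ρ<3 (trans q (cong suc (sym p))))
... | inj₂ p | inj₁ q = ⊥-elim (not-consecutive (own a) (own c) ρ ρ<3 (trans p (cong suc (sym q))))

ap-end-positive : ∀ {x y z} → x < y → x + z ≡ 2 * y → 0 < z
ap-end-positive {z = suc _} _ _ = s≤s z≤n
ap-end-positive {x} {y} {zero} x<y e = ⊥-elim (<⇒≱ x<y (begin
  y           ≤⟨ m≤m+n y (y + 0) ⟩
  2 * y       ≡⟨ e ⟨
  x + 0       ≡⟨ +-identityʳ x ⟩
  x           ∎))
  where open ≤-Reasoning

-- Each sequence is 3-free, by strong induction on the largest term: a progression with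
-- equal last digits comes from a progression of parents inside one smaller sequence.
classes-3-free : ∀ z → NoAPEndingAt z
classes-3-free = <-rec NoAPEndingAt step
  where
  step : ∀ z → (∀ {w} → w < z → NoAPEndingAt w) → NoAPEndingAt z
  step z ih x y x<y ox oy e with ternary-view z | ternary-view x | ternary-view y
  ... | ternary γ ρz lz | ternary α ρx lx | ternary β ρy ly
    with ap-digits ρx ρy lx ly (ap-third-digit α β γ ρx ρy ρz lz e)
  ... | inj₂ (x≢y , x≢z , y≢z) = no-three-digits α β γ lx ly lz ox oy refl x≢y x≢z y≢z
  ... | inj₁ (refl , refl) =
    ih (parent< γ ρx (ap-end-positive x<y e)) α β α<β
       (same-digit-parents α γ lx ox) (same-digit-parents β γ lx oy) parents-ap
    where
    α<β : α < β
    α<β = *-cancelˡ-< 3 α β (+-cancelʳ-< ρx (3 * α) (3 * β) x<y)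
    parents-ap : α + γ ≡ 2 * β
    parents-ap = *-cancelˡ-≡ (α + γ) (2 * β) 3
      (+-cancelʳ-≡ (2 * ρx) _ _ (trans (l α γ ρx) (trans e (r β ρx))))
      where
      l : ∀ a c ρ → 3 * (a + c) + 2 * ρ ≡ (3 * a + ρ) + (3 * c + ρ)
      l = solve-∀
      r : ∀ b ρ → 2 * (3 * b + ρ) ≡ 3 * (2 * b) + 2 * ρ
      r = solve-∀

-- The induction on the ternary digits of m and n needs two
-- companion configurations, so we prove three "shapes" of witnesses at once.

record Form : Set where
  constructor form
  field
    strict : Bool
    d cL cR : ℕ

Order : Bool → ℕ → ℕ → Set
Order true  = _<_
Order false = _≤_

Witness : Form → ℕ → ℕ → Set
Witness F m n = Σ ℕ λ x → Σ ℕ λ y →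
  Order (Form.strict F) x y × own x ≡ n × own y ≡ n + Form.d F ×
  x + m + Form.cL F ≡ 2 * y + Form.cR F

-- progression: x < y with x + m = 2y (m completes a 3-AP in S_n);
-- shifted:     x < y with y ∈ S_(n+1) and x + m + 1 = 2y;
-- near:        x ≤ y with x + m = 2y + 1.
data Shape : Set where
  progression shifted near : Shape

shapeForm : Shape → Form
shapeForm progression = form true 0 0 0
shapeForm shifted     = form true 1 1 0
shapeForm near        = form false 0 0 1

Blocked : ℕ → Set
Blocked m = ∀ s n → suc n ≤ own m → Witness (shapeForm s) m n

-- A witness for 3b + t is built from a witness for the parent b of some shape, or from
-- the weak progression x ≤ y, x + b = 2y, which also exists for n = own b (take x = y = b).
data Source : Set where
  from     : Shape → Source
  diagonal : Source

sourceForm : Source → Form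
sourceForm (from s)  = shapeForm s
sourceForm diagonal  = form false 0 0 0

-- How far below own b the parent index must lie for the source to be available.
slack : Source → ℕ
slack (from _) = 1
slack diagonal = 0

source-witness : ∀ {b} → Blocked b → ∀ src n → slack src + n ≤ own b →
  Witness (sourceForm src) b n
source-witness blocked (from s) n h = blocked s n h
source-witness {b} blocked diagonal n h with n ≟ own b
... | yes refl = b , b , ≤-refl , refl , sym (+-identityʳ n) , double b
  where
  double : ∀ b → b + b + 0 ≡ 2 * b + 0
  double = solve-∀
... | no n≢own with blocked progression n (≤∧≢⇒< h n≢own)
... | x , y , x<y , ox , oy , e = x , y , <⇒≤ x<y , ox , oy , e

-- A lifting rule: take the parent witness (α, β) for index 2j + cx and use
-- x = 3α + ρx, y = 3β + ρy as the witness for 3b + t and index 3j + κ.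
record Rule : Set where
  constructor rule
  field
    source : Source
    cx ρx ρy : ℕ

OrderLift : Bool → Bool → ℕ → ℕ → Set
OrderLift true  _ _  _  = ⊤
OrderLift false s ρx ρy = Order s ρx ρy

-- The conditions making a rule correct for target shape s, last digit t of m and κ of n;
-- they only involve the digits, so they can be checked by computation.
Valid : Shape → ℕ → ℕ → Rule → Set
Valid s t κ (rule src cx ρx ρy) =
  ρx < 3 × ρy < 3 ×
  ⌊ 3 * cx + ρx /2⌋ ≡ κ × ⌊ 3 * (cx + Form.d F') + ρy /2⌋ ≡ κ + Form.d F ×
  ρx + t + Form.cL F + 3 * Form.cR F' ≡ 2 * ρy + Form.cR F + 3 * Form.cL F' ×
  OrderLift (Form.strict F') (Form.strict F) ρx ρy ×
  3 * (slack src + cx) + t ≤ 2 * κ + 4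
  where
  F  = shapeForm s
  F' = sourceForm src

order? : ∀ s x y → Dec (Order s x y)
order? true  = _<?_
order? false = _≤?_

orderLift? : ∀ s' s ρx ρy → Dec (OrderLift s' s ρx ρy)
orderLift? true  _ _  _  = yes tt
orderLift? false s ρx ρy = order? s ρx ρy

valid? : ∀ s t κ r → Dec (Valid s t κ r)
valid? s t κ (rule src cx ρx ρy) =
  ρx <? 3 ×-dec ρy <? 3 ×-dec
  ⌊ 3 * cx + ρx /2⌋ ≟ κ ×-dec ⌊ 3 * (cx + Form.d F') + ρy /2⌋ ≟ κ + Form.d F ×-dec
  ρx + t + Form.cL F + 3 * Form.cR F' ≟ 2 * ρy + Form.cR F + 3 * Form.cL F' ×-dec
  orderLift? (Form.strict F') (Form.strict F) ρx ρy ×-dec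
  3 * (slack src + cx) + t ≤? 2 * κ + 4
  where
  F  = shapeForm s
  F' = sourceForm src

digits : List ℕ
digits = 0 ∷ 1 ∷ 2 ∷ []

digit∈ : ∀ {t} → t < 3 → t ∈ digits
digit∈ {0} _ = here refl
digit∈ {1} _ = there (here refl)
digit∈ {2} _ = there (there (here refl))
digit∈ {suc (suc (suc _))} (s≤s (s≤s (s≤s ())))

shapes : List Shape
shapes = progression ∷ shifted ∷ near ∷ []

shape∈ : ∀ s → s ∈ shapes
shape∈ progression = here refl
shape∈ shifted     = there (here refl)
shape∈ near        = there (there (here refl))

candidates : List Rule
candidates =
  concatMap (λ src → concatMap (λ cx → concatMap (λ ρx →
    map (rule src cx ρx) digits) digits) digits)
            (diagonal ∷ map from shapes)

rules-complete :
  All (λ s → All (λ t → All (λ κ → Any (Valid s t κ) candidates) digits) digits) shapes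
rules-complete = toWitness {a? = all? (λ s → all? (λ t → all? (λ κ →
  any? (valid? s t κ) candidates) digits) digits) shapes} tt

rule-for : ∀ s {t κ} → t < 3 → κ < 3 → ∃ (Valid s t κ)
rule-for s t<3 κ<3 =
  satisfied (All.lookup (All.lookup (All.lookup rules-complete (shape∈ s))
                                    (digit∈ t<3)) (digit∈ κ<3))

order-lift : ∀ s' s {α β ρx ρy} → ρx < 3 → OrderLift s' s ρx ρy → Order s' α β →
  Order s (3 * α + ρx) (3 * β + ρy)
order-lift true  true  ρx<3 _ α<β = ternary-< ρx<3 α<β
order-lift true  false ρx<3 _ α<β = <⇒≤ (ternary-< ρx<3 α<β)
order-lift false true  _ ρx<ρy α≤β = +-mono-≤-< (*-monoʳ-≤ 3 α≤β) ρx<ρy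
order-lift false false _ ρx≤ρy α≤β = +-mono-≤ (*-monoʳ-≤ 3 α≤β) ρx≤ρy

-- The progression equation for the children follows from the parents' one and the
-- equation on the last digits (carries cL', cR' of the parents become 3cL', 3cR').
equation-lift : ∀ α β b ρx ρy t cL cR cL' cR' → α + b + cL' ≡ 2 * β + cR' →
  ρx + t + cL + 3 * cR' ≡ 2 * ρy + cR + 3 * cL' →
  3 * α + ρx + (3 * b + t) + cL ≡ 2 * (3 * β + ρy) + cR
equation-lift α β b ρx ρy t cL cR cL' cR' parents last = +-cancelʳ-≡ (3 * cL') _ _ (begin
  3 * α + ρx + (3 * b + t) + cL + 3 * cL'   ≡⟨ l₁ α b ρx t cL cL' ⟩
  3 * (α + b + cL') + (ρx + t + cL)         ≡⟨ cong (λ v → 3 * v + (ρx + t + cL)) parents ⟩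
  3 * (2 * β + cR') + (ρx + t + cL)         ≡⟨ l₂ β cR' ρx t cL ⟩
  6 * β + (ρx + t + cL + 3 * cR')           ≡⟨ cong (6 * β +_) last ⟩
  6 * β + (2 * ρy + cR + 3 * cL')           ≡⟨ l₃ β ρy cR cL' ⟩
  2 * (3 * β + ρy) + cR + 3 * cL'           ∎)
  where
  open ≡-Reasoning
  l₁ : ∀ α b ρx t cL cL' → 3 * α + ρx + (3 * b + t) + cL + 3 * cL' ≡ 3 * (α + b + cL') + (ρx + t + cL)
  l₁ = solve-∀
  l₂ : ∀ β cR' ρx t cL → 3 * (2 * β + cR') + (ρx + t + cL) ≡ 6 * β + (ρx + t + cL + 3 * cR')
  l₂ = solve-∀
  l₃ : ∀ β ρy cR cL' → 6 * β + (2 * ρy + cR + 3 * cL') ≡ 2 * (3 * β + ρy) + cR + 3 * cL'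
  l₃ = solve-∀

parent-bound : ∀ b t j κ k cx → t < 3 → suc (3 * j + κ) ≤ own (3 * b + t) →
  3 * (k + cx) + t ≤ 2 * κ + 4 → k + (2 * j + cx) ≤ own b
parent-bound b t j κ k cx t<3 h bound =
  ≤-pred (*-cancelˡ-< 3 X (suc (own b))
    (≤-trans (s≤s (+-cancelʳ-≤ t _ _ chain)) (≤-reflexive (l₄ (own b)))))
  where
  open ≤-Reasoning
  X = k + (2 * j + cx)
  chain : 3 * X + t ≤ 3 * own b + 2 + t
  chain = begin
    3 * X + t                      ≡⟨ l₁ k j cx t ⟩
    6 * j + (3 * (k + cx) + t)     ≤⟨ +-monoʳ-≤ (6 * j) bound ⟩
    6 * j + (2 * κ + 4)            ≡⟨ l₂ j κ ⟩
    2 * suc (3 * j + κ) + 2        ≤⟨ +-monoˡ-≤ 2 (*-monoʳ-≤ 2 h) ⟩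
    2 * own (3 * b + t) + 2        ≡⟨ cong (λ v → 2 * v + 2) (own-digit b t t<3) ⟩
    2 * ⌊ 3 * own b + t /2⌋ + 2    ≤⟨ +-monoˡ-≤ 2 (2⌊s/2⌋≤s (3 * own b + t)) ⟩
    3 * own b + t + 2              ≡⟨ l₃ (own b) t ⟩
    3 * own b + 2 + t              ∎
    where
    l₁ : ∀ k j cx t → 3 * (k + (2 * j + cx)) + t ≡ 6 * j + (3 * (k + cx) + t)
    l₁ = solve-∀
    l₂ : ∀ j κ → 6 * j + (2 * κ + 4) ≡ 2 * suc (3 * j + κ) + 2
    l₂ = solve-∀
    l₃ : ∀ p t → 3 * p + t + 2 ≡ 3 * p + 2 + t
    l₃ = solve-∀
  l₄ : ∀ p → suc (3 * p + 2) ≡ 3 * suc p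
  l₄ = solve-∀

apply-rule : ∀ s b t j κ (r : Rule) → Valid s t κ r →
  Witness (sourceForm (Rule.source r)) b (2 * j + Rule.cx r) →
  Witness (shapeForm s) (3 * b + t) (3 * j + κ)
apply-rule s b t j κ (rule src cx ρx ρy) (ρx<3 , ρy<3 , slot-x , slot-y , last , ord , _)
           (α , β , αβ , oα , oβ , e) =
  3 * α + ρx , 3 * β + ρy ,
  order-lift (Form.strict F') (Form.strict F) ρx<3 ord αβ ,
  trans (own-lift α j cx ρx<3 oα) (cong (3 * j +_) slot-x) ,
  trans (own-lift β j (cx + Form.d F') ρy<3 (trans oβ (+-assoc (2 * j) cx (Form.d F'))))
        (trans (cong (3 * j +_) slot-y) (sym (+-assoc (3 * j) κ (Form.d F)))) ,
  equation-lift α β b ρx ρy t (Form.cL F) (Form.cR F) (Form.cL F') (Form.cR F') e last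
  where
  F  = shapeForm s
  F' = sourceForm src

own-positive : ∀ m {k} → suc k ≤ own m → 0 < m
own-positive (suc m) _ = s≤s z≤n

blocked : ∀ m → Blocked m
blocked = <-rec Blocked step
  where
  step : ∀ m → (∀ {b} → b < m → Blocked b) → Blocked m
  step m ih s n h with ternary-view m | ternary-view n
  ... | ternary b t t<3 | ternary j κ κ<3 = lift-by (rule-for s t<3 κ<3)
    where
    lift-by : ∃ (Valid s t κ) → Witness (shapeForm s) (3 * b + t) (3 * j + κ)
    lift-by (r@(rule src cx _ _) , valid@(_ , _ , _ , _ , _ , _ , bound)) =
      apply-rule s b t j κ r valid
        (source-witness (ih (parent< b t (own-positive (3 * b + t) h))) src (2 * j + cx)
          (parent-bound b t j κ (slack src) cx t<3 h bound))

-- The greedy construction puts every m into S_(own m).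

false≢true : false ≢ true
false≢true ()

creates-AP⁻ : ∀ L m → createsAP L m ≡ true →
  Σ ℕ λ x → Σ ℕ λ y → x ∈ L × y ∈ L × x < y × x + m ≡ 2 * y
creates-AP⁻ L m e with find (any⁻ _ L (Equivalence.from T-≡ e))
... | x , x∈L , some-y with find (any⁻ _ L some-y)
... | y , y∈L , test with Equivalence.to T-∧ test
... | x<y , x+m≡2y = x , y , x∈L , y∈L , <ᵇ⇒< x y x<y , ≡ᵇ⇒≡ (x + m) (2 * y) x+m≡2y

creates-AP⁺ : ∀ {L m x y} → x ∈ L → y ∈ L → x < y → x + m ≡ 2 * y → createsAP L m ≡ true
creates-AP⁺ {m = m} {x} {y} x∈L y∈L x<y e =
  Equivalence.to T-≡ (any⁺ _ (lose x∈L (any⁺ _ (lose y∈L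
    (Equivalence.from T-∧ (<⇒<ᵇ x<y , ≡⇒≡ᵇ (x + m) (2 * y) e))))))

HistCorrect : ℕ → Set
HistCorrect m = ∀ n x →
  (x ∈ hist m n → x < m × own x ≡ n) × (x < m → own x ≡ n → x ∈ hist m n)

module GreedyStep {m : ℕ} (hist-ok : HistCorrect m) where

  no-AP-in-own : createsAP (hist m (own m)) m ≡ false
  no-AP-in-own with createsAP (hist m (own m)) m in e
  ... | false = refl
  ... | true with creates-AP⁻ _ m e
  ... | x , y , x∈ , y∈ , x<y , ap =
    ⊥-elim (classes-3-free m x y x<y (proj₂ (proj₁ (hist-ok _ x) x∈))
                                     (proj₂ (proj₁ (hist-ok _ y) y∈)) ap)

  AP-in-lower : ∀ {n} → n < own m → createsAP (hist m n) m ≡ true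
  AP-in-lower {n} n<own with blocked m progression n n<own
  ... | x , y , x<y , ox , oy , e =
    creates-AP⁺ (proj₂ (hist-ok n x) x<m ox) (proj₂ (hist-ok n y) y<m oy′) x<y ap
    where
    oy′ : own y ≡ n
    oy′ = trans oy (+-identityʳ n)
    ap : x + m ≡ 2 * y
    ap = trans (sym (+-identityʳ (x + m))) (trans e (+-identityʳ (2 * y)))
    y<m : y < m
    y<m = +-cancelˡ-< y y m (begin-strict
      y + y     ≡⟨ cong (y +_) (+-identityʳ y) ⟨
      2 * y     ≡⟨ ap ⟨
      x + m     <⟨ +-monoˡ-< m x<y ⟩
      y + m     ∎)
      where open ≤-Reasoning
    x<m : x < m
    x<m = <-trans x<y y<m

  joins-below : ∀ {n} → n < own m → joins (hist m) m n ≡ false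
  joins-below {n} n<own =
    trans (cong (λ c → not (usedBefore (hist m) m n) ∧ not c) (AP-in-lower n<own)) (∧-zeroʳ _)

  usedBefore-upto : ∀ n → n ≤ own m → usedBefore (hist m) m n ≡ false
  usedBefore-upto zero    _      = refl
  usedBefore-upto (suc n) n<own = cong₂ _∨_ (usedBefore-upto n (<⇒≤ n<own)) (joins-below n<own)

  joins-own : joins (hist m) m (own m) ≡ true
  joins-own = cong₂ (λ u c → not u ∧ not c) (usedBefore-upto (own m) ≤-refl) no-AP-in-own

  usedBefore-after : ∀ n → own m < n → usedBefore (hist m) m n ≡ true
  usedBefore-after (suc n) own<1+n with m≤n⇒m<n∨m≡n (≤-pred own<1+n)
  ... | inj₁ own<n = cong (_∨ joins (hist m) m n) (usedBefore-after n own<n)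
  ... | inj₂ refl  = trans (cong (usedBefore (hist m) m n ∨_) joins-own) (∨-zeroʳ _)

  joins-above : ∀ {n} → own m < n → joins (hist m) m n ≡ false
  joins-above {n} own<n = cong (λ u → not u ∧ not (createsAP (hist m n) m)) (usedBefore-after n own<n)

  joins⇒own : ∀ n → joins (hist m) m n ≡ true → own m ≡ n
  joins⇒own n j with <-cmp (own m) n
  ... | tri< own<n _ _ = ⊥-elim (false≢true (trans (sym (joins-above own<n)) j))
  ... | tri≈ _ e _     = e
  ... | tri> _ _ n<own = ⊥-elim (false≢true (trans (sym (joins-below n<own)) j))

hist-correct : ∀ m → HistCorrect m
hist-correct zero    n x = (λ ()) , (λ ())
hist-correct (suc m) n x = forward , backward
  where
  open GreedyStep (hist-correct m)
  forward : x ∈ hist (suc m) n → x < suc m × own x ≡ n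
  forward x∈ with ∈-++⁻ (hist m n) x∈
  ... | inj₁ x∈old = let x<m , ox = proj₁ (hist-correct m n x) x∈old in m<n⇒m<1+n x<m , ox
  ... | inj₂ x∈new with joins (hist m) m n in j
  ... | true  with x∈new
  ... | here refl = ≤-refl , joins⇒own n j
  forward x∈ | inj₂ x∈new | false with x∈new
  ... | ()
  backward : x < suc m → own x ≡ n → x ∈ hist (suc m) n
  backward x<1+m ox with m≤n⇒m<n∨m≡n (≤-pred x<1+m)
  ... | inj₁ x<m = ∈-++⁺ˡ (proj₂ (hist-correct m n x) x<m ox)
  ... | inj₂ refl rewrite sym ox | joins-own = ∈-++⁺ʳ (hist x (own x)) (here refl)

in-own : ∀ m → InS (own m) m
in-own m = GreedyStep.joins-own (hist-correct m)

in⇒own : ∀ n m → InS n m → own m ≡ n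
in⇒own n m = GreedyStep.joins⇒own (hist-correct m) n

-- Appending a digit to the base-3 and base-3/2 representations.

base3go-fuel : ∀ f g k → k < f → k < g → base3go f (suc k) ≡ base3go g (suc k)
base3go-fuel (suc f) (suc g) k (s≤s k≤f) (s≤s k≤g) with suc k / 3 in eq
... | zero  = refl
... | suc q = cong (suc k % 3 ∷_) (base3go-fuel f g q (<-≤-trans q<k k≤f) (<-≤-trans q<k k≤g))
  where
  q<k : q < k
  q<k = ≤-pred (subst (_< suc k) eq (m/n<m (suc k) 3 (s≤s (s≤s z≤n))))

base32go-fuel : ∀ f g k → k < f → k < g → base32go f (suc k) ≡ base32go g (suc k)
base32go-fuel (suc f) (suc g) k (s≤s k≤f) (s≤s k≤g) with suc k / 3 in eq
... | zero  = refl
... | suc q = cong (suc k % 3 ∷_) (base32go-fuel f g _ (<-≤-trans 2q′<k k≤f) (<-≤-trans 2q′<k k≤g))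
  where
  open ≤-Reasoning
  -- 2(q + 1) = suc (q + suc (q + 0)) is smaller than 3(q + 1) ≤ k + 1
  2q′<k : q + suc (q + 0) < k
  2q′<k = ≤-pred (begin-strict
    2 * suc q       <⟨ m<m+n (2 * suc q) (s≤s z≤n) ⟩
    2 * suc q + suc q ≡⟨ solve-∀′ q ⟩
    suc q * 3       ≡⟨ cong (_* 3) eq ⟨
    suc k / 3 * 3   ≤⟨ m/n*n≤m (suc k) 3 ⟩
    suc k           ∎)
    where
    solve-∀′ : ∀ q → 2 * suc q + suc q ≡ suc q * 3
    solve-∀′ = solve-∀

base3go-step : ∀ f n q → n / 3 ≡ suc q → base3go (suc f) n ≡ n % 3 ∷ base3go f (suc q)
base3go-step f n q e with n / 3
base3go-step f n q refl | .(suc q) = refl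

base32go-step : ∀ f n q → n / 3 ≡ suc q → base32go (suc f) n ≡ n % 3 ∷ base32go f (2 * suc q)
base32go-step f n q e with n / 3
base32go-step f n q refl | .(suc q) = refl

base3-snoc : ∀ b t → 1 ≤ b → t < 3 → base3 (3 * b + t) ≡ base3 b ++ t ∷ []
base3-snoc b@(suc b′) t _ t<3 = begin
  reverse (base3go (3 * b + t) (3 * b + t))            ≡⟨ cong reverse (base3go-step f (3 * b + t) b′ quo) ⟩
  reverse ((3 * b + t) % 3 ∷ base3go f b)              ≡⟨ cong (λ r → reverse (r ∷ base3go f b)) rem ⟩
  reverse (t ∷ base3go f b)                            ≡⟨ unfold-reverse t (base3go f b) ⟩
  reverse (base3go f b) ++ t ∷ []                      ≡⟨ cong (λ ds → reverse ds ++ t ∷ []) fuel ⟩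
  reverse (base3go b b) ++ t ∷ []                      ∎
  where
  open ≡-Reasoning
  f = pred (3 * b + t)
  quo = proj₁ (divmod-digit b t t<3)
  rem = proj₂ (divmod-digit b t t<3)
  fuel = base3go-fuel f b b′ (≤-pred (parent< b t (s≤s z≤n))) ≤-refl

base32-snoc : ∀ q r → 1 ≤ q → r < 3 → base32 (3 * q + r) ≡ base32 (2 * q) ++ r ∷ []
base32-snoc q@(suc q′) r _ r<3 = begin
  reverse (base32go (3 * q + r) (3 * q + r))           ≡⟨ cong reverse (base32go-step f (3 * q + r) q′ quo) ⟩
  reverse ((3 * q + r) % 3 ∷ base32go f (2 * q))       ≡⟨ cong (λ ρ → reverse (ρ ∷ base32go f (2 * q))) rem ⟩
  reverse (r ∷ base32go f (2 * q))                     ≡⟨ unfold-reverse r (base32go f (2 * q)) ⟩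
  reverse (base32go f (2 * q)) ++ r ∷ []               ≡⟨ cong (λ ds → reverse ds ++ r ∷ []) fuel ⟩
  reverse (base32go (2 * q) (2 * q)) ++ r ∷ []         ∎
  where
  open ≡-Reasoning
  f = pred (3 * q + r)
  quo = proj₁ (divmod-digit q r r<3)
  rem = proj₂ (divmod-digit q r r<3)
  2q<3q+r : 2 * q < 3 * q + r
  2q<3q+r = <-≤-trans (m<m+n (2 * q) (s≤s z≤n))
                      (≤-trans (≤-reflexive (l q)) (m≤m+n (3 * q) r))
    where
    l : ∀ q → 2 * q + q ≡ 3 * q
    l = solve-∀
  fuel = base32go-fuel f (2 * q) _ (≤-pred 2q<3q+r) ≤-refl

FirstOf : ℕ → ℕ → Set
FirstOf i s = own s ≡ i × (∀ k → k < s → own k < i)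

ternary-order : ∀ {a r s ρ} → r < 3 → ρ < 3 → 3 * a + r < 3 * s + ρ → a < s ⊎ (a ≡ s × r < ρ)
ternary-order {a} {r} {s} {ρ} r<3 ρ<3 lt with <-cmp a s
... | tri< a<s _ _  = inj₁ a<s
... | tri≈ _ refl _ = inj₂ (refl , +-cancelˡ-< (3 * a) r ρ lt)
... | tri> _ _ s<a  = ⊥-elim (<-asym lt (ternary-< ρ<3 s<a))

first-step : ∀ {q s i ρ} → ρ < 3 → 2 * i ≡ 3 * q + ρ → FirstOf q s → FirstOf i (3 * s + ρ)
first-step {q} {s} {i} {ρ} ρ<3 2i≡ (own-s , below) = own-new , below-new
  where
  open ≤-Reasoning
  own-new : own (3 * s + ρ) ≡ i
  own-new = begin-equality
    own (3 * s + ρ)         ≡⟨ own-digit s ρ ρ<3 ⟩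
    ⌊ 3 * own s + ρ /2⌋     ≡⟨ cong (λ v → ⌊ 3 * v + ρ /2⌋) own-s ⟩
    ⌊ 3 * q + ρ /2⌋         ≡⟨ cong ⌊_/2⌋ 2i≡ ⟨
    ⌊ 2 * i /2⌋             ≡⟨ ⌊2a/2⌋ i ⟩
    i                       ∎
  parent-value : ∀ a r → r < 3 → 3 * a + r < 3 * s + ρ → 3 * own a + r < 3 * q + ρ
  parent-value a r r<3 lt with ternary-order r<3 ρ<3 lt
  ... | inj₁ a<s         = ternary-< r<3 (below a a<s)
  ... | inj₂ (refl , r<ρ) = subst (λ v → 3 * v + r < 3 * q + ρ) (sym own-s) (+-monoʳ-< (3 * q) r<ρ)
  below-new : ∀ k → k < 3 * s + ρ → own k < i
  below-new k k<s′ with ternary-view k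
  ... | ternary a r r<3 = *-cancelˡ-< 2 (own (3 * a + r)) i (begin-strict
    2 * own (3 * a + r)        ≡⟨ cong (2 *_) (own-digit a r r<3) ⟩
    2 * ⌊ 3 * own a + r /2⌋    ≤⟨ 2⌊s/2⌋≤s (3 * own a + r) ⟩
    3 * own a + r              <⟨ parent-value a r r<3 k<s′ ⟩
    3 * q + ρ                  ≡⟨ 2i≡ ⟨
    2 * i                      ∎)

-- The ternary view as an equation, for numbers given by an expression such as 2i.
ternary-split : ∀ n → Σ ℕ λ b → Σ ℕ λ t → t < 3 × n ≡ 3 * b + t
ternary-split n with ternary-view n
... | ternary b t t<3 = b , t , t<3 , refl

parent-index : ∀ i q {ρ} → 2 ≤ i → ρ < 3 → 2 * i ≡ 3 * q + ρ → 1 ≤ q × q < i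
parent-index i zero {ρ} 2≤i ρ<3 e = ⊥-elim (<⇒≱ ρ<3 (begin
  3            ≤⟨ s≤s (s≤s (s≤s z≤n)) ⟩
  2 * 2        ≤⟨ *-monoʳ-≤ 2 2≤i ⟩
  2 * i        ≡⟨ e ⟩
  ρ            ∎))
  where open ≤-Reasoning
parent-index i q@(suc _) {ρ} 2≤i ρ<3 e = s≤s z≤n , *-cancelˡ-< 3 q i (begin-strict
  3 * q        ≤⟨ m≤m+n (3 * q) ρ ⟩
  3 * q + ρ    ≡⟨ e ⟨
  2 * i        <⟨ m<m+n (2 * i) (<-≤-trans (s≤s z≤n) 2≤i) ⟩
  2 * i + i    ≡⟨ l i ⟩
  3 * i        ∎)
  where
  open ≤-Reasoning
  l : ∀ i → 2 * i + i ≡ 3 * i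
  l = solve-∀

first-terms : ∀ i → Σ ℕ λ s → FirstOf i s × base3 s ≡ base32 (2 * i)
first-terms = <-rec _ step
  where
  step : ∀ i → (∀ {q} → q < i → Σ ℕ λ s → FirstOf q s × base3 s ≡ base32 (2 * q)) →
         Σ ℕ λ s → FirstOf i s × base3 s ≡ base32 (2 * i)
  step 0 _ = 0 , (refl , λ _ ()) , refl
  step 1 _ = 2 , (refl , below-2) , refl
    where
    below-2 : ∀ k → k < 2 → own k < 1
    below-2 0 _ = s≤s z≤n
    below-2 1 _ = s≤s z≤n
    below-2 (suc (suc _)) (s≤s (s≤s ()))
  step i@(suc (suc _)) ih with ternary-split (2 * i)
  ... | q , ρ , ρ<3 , e with parent-index i q (s≤s (s≤s z≤n)) ρ<3 e
  ... | q≥1 , q<i with ih q<i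
  ... | s , first@(own-s , _) , digits = 3 * s + ρ , first-step ρ<3 e first , (begin
    base3 (3 * s + ρ)           ≡⟨ base3-snoc s ρ s≥1 ρ<3 ⟩
    base3 s ++ ρ ∷ []           ≡⟨ cong (_++ ρ ∷ []) digits ⟩
    base32 (2 * q) ++ ρ ∷ []    ≡⟨ base32-snoc q ρ q≥1 ρ<3 ⟨
    base32 (3 * q + ρ)          ≡⟨ cong base32 e ⟨
    base32 (2 * i)              ∎)
    where
    open ≡-Reasoning
    s≥1 : 1 ≤ s
    s≥1 = own-positive s (≤-trans q≥1 (≤-reflexive (sym own-s)))

theorem1 : (i : ℕ) → Σ ℕ (λ s → IsFirstTerm i s × base3 s ≡ base32 (2 * i))
theorem1 i with first-terms i
... | s , (own-s , below) , digits = s , (s∈S_i , earlier-not-in) , digits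
  where
  s∈S_i : InS i s
  s∈S_i = subst (λ n → InS n s) own-s (in-own s)
  earlier-not-in : ∀ k → k < s → ¬ InS i k
  earlier-not-in k k<s k∈S_i = <-irrefl (in⇒own i k k∈S_i) (below k k<s)
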